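{- Let $p$ be a prime, $n$ a positive integer, $q=p^n$, and let $\mathbb{F}_q$ be the finite field with $q$ elements. The multiplicative group $\mathbb{F}_q^{\times}$ is a linear space (over some field) if and only if $q=2$, $q=3$, or $q-1$ is a Mersenne prime.
   Context: An abelian group $G$ (written multiplicatively) is said to be a linear space over a field $K$ if there is a scalar multiplication $K\times G\to G$ making $G$, with its group operation as vector addition, a vector space over $K$; "$G$ is a linear space" means it is a linear space over some field $K$. A prime $p'$ is a Mersenne prime if $p'=2^r-1$ for some integer $r$. -}

module Defs where

open import Level using (Level; _⊔_) renaming (suc to lsuc)
open import Data.Nat using (ℕ; _^_; _∸_)
open import Data.Nat.Primality using (Prime)
open import Data.Product using (Σ; Σ-syntax; ∃-syntax; _×_; _,_; proj₁; proj₂)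
open import Relation.Nullary using (¬_)
open import Relation.Binary.PropositionalEquality using (_≡_)
open import Algebra.Bundles using (CommutativeRing; Ring; AbelianGroup)
open import Algebra.Module.Structures using (IsLeftModule)
import Relation.Binary.Reasoning.Setoid as SetoidReasoning

record Field (c ℓ : Level) : Set (lsuc (c ⊔ ℓ)) where
  field
    commutativeRing : CommutativeRing c ℓ
  open CommutativeRing commutativeRing public
  field
    0≉1 : ¬ (0# ≈ 1#)
    inv : (x : Carrier) → ¬ (x ≈ 0#) → Σ[ y ∈ Carrier ] (x * y ≈ 1#)

module _ {c ℓ : Level} (F : Field c ℓ) where
  open Field F

  open SetoidReasoning setoid

  private
    nz-mul : ∀ {x y} → ¬ (x ≈ 0#) → ¬ (y ≈ 0#) → ¬ (x * y ≈ 0#)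
    nz-mul {x} {y} x≉0 y≉0 xy≈0 = y≉0 (begin
      y                  ≈⟨ sym (*-identityˡ y) ⟩
      1# * y             ≈⟨ *-congʳ (sym (proj₂ (inv x x≉0))) ⟩
      (x * x') * y       ≈⟨ *-congʳ (*-comm x x') ⟩
      (x' * x) * y       ≈⟨ *-assoc x' x y ⟩
      x' * (x * y)       ≈⟨ *-congˡ xy≈0 ⟩
      x' * 0#            ≈⟨ zeroʳ x' ⟩
      0#                 ∎)
      where x' = proj₁ (inv x x≉0)

    nz-inv : ∀ x (x≉0 : ¬ (x ≈ 0#)) → ¬ (proj₁ (inv x x≉0) ≈ 0#)
    nz-inv x x≉0 x'≈0 = 0≉1 (begin
      0#        ≈⟨ sym (zeroʳ x) ⟩
      x * 0#    ≈⟨ *-congˡ (sym x'≈0) ⟩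
      x * proj₁ (inv x x≉0) ≈⟨ proj₂ (inv x x≉0) ⟩
      1#        ∎)

  U : Set (c ⊔ ℓ)
  U = Σ[ x ∈ Carrier ] ¬ (x ≈ 0#)

  _≈U_ : U → U → Set ℓ
  a ≈U b = proj₁ a ≈ proj₁ b

  _∙U_ : U → U → U
  (x , x≉0) ∙U (y , y≉0) = (x * y , nz-mul x≉0 y≉0)

  1U : U
  1U = (1# , λ 1≈0 → 0≉1 (sym 1≈0))

  _⁻¹U : U → U
  (x , x≉0) ⁻¹U = (proj₁ (inv x x≉0) , nz-inv x x≉0)

  private
    inverseʳU : ∀ a → (a ∙U (a ⁻¹U)) ≈U 1U
    inverseʳU (x , x≉0) = proj₂ (inv x x≉0)

    inverseˡU : ∀ a → ((a ⁻¹U) ∙U a) ≈U 1U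
    inverseˡU (x , x≉0) = trans (*-comm _ x) (proj₂ (inv x x≉0))

    inv-cong : ∀ {a b} → a ≈U b → (a ⁻¹U) ≈U (b ⁻¹U)
    inv-cong {x , x≉0} {y , y≉0} x≈y = begin
      x'             ≈⟨ sym (*-identityʳ x') ⟩
      x' * 1#        ≈⟨ *-congˡ (sym (proj₂ (inv y y≉0))) ⟩
      x' * (y * y')  ≈⟨ sym (*-assoc x' y y') ⟩
      (x' * y) * y'  ≈⟨ *-congʳ (*-congˡ (sym x≈y)) ⟩
      (x' * x) * y'  ≈⟨ *-congʳ (*-comm x' x) ⟩
      (x * x') * y'  ≈⟨ *-congʳ (proj₂ (inv x x≉0)) ⟩
      1# * y'        ≈⟨ *-identityˡ y' ⟩
      y'             ∎
      where
        x' = proj₁ (inv x x≉0)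
        y' = proj₁ (inv y y≉0)

  unitGroup : AbelianGroup (c ⊔ ℓ) ℓ
  unitGroup = record
    { Carrier = U
    ; _≈_ = _≈U_
    ; _∙_ = _∙U_
    ; ε = 1U
    ; _⁻¹ = _⁻¹U
    ; isAbelianGroup = record
      { isGroup = record
        { isMonoid = record
          { isSemigroup = record
            { isMagma = record
              { isEquivalence = record { refl = refl ; sym = sym ; trans = trans }
              ; ∙-cong = *-cong
              }
            ; assoc = λ a b c → *-assoc (proj₁ a) (proj₁ b) (proj₁ c)
            }
          ; identity = (λ a → *-identityˡ (proj₁ a)) , (λ a → *-identityʳ (proj₁ a))
          }
        ; inverse = inverseˡU , inverseʳU
        ; ⁻¹-cong = inv-cong
        }
      ; comm = λ a b → *-comm (proj₁ a) (proj₁ b)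
      }
    }

IsLinearSpaceOver : ∀ {k kℓ g gℓ} → Field k kℓ → AbelianGroup g gℓ → Set (k ⊔ kℓ ⊔ g ⊔ gℓ)
IsLinearSpaceOver K G =
  Σ[ smul ∈ (Field.Carrier K → AbelianGroup.Carrier G → AbelianGroup.Carrier G) ]
    IsLeftModule (Field.ring K) (AbelianGroup._≈_ G) (AbelianGroup._∙_ G)
                 (AbelianGroup.ε G) (AbelianGroup._⁻¹ G) smul

IsLinearSpace : ∀ (k kℓ : Level) {g gℓ} → AbelianGroup g gℓ → Set (lsuc (k ⊔ kℓ) ⊔ g ⊔ gℓ)
IsLinearSpace k kℓ G = Σ[ K ∈ Field k kℓ ] IsLinearSpaceOver K G

MersennePrime : ℕ → Set
MersennePrime m = Prime m × ∃[ r ] (m ≡ 2 ^ r ∸ 1)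

{-# OPTIONS --safe #-}
module Submission where

-- Let F^× have order m = q − 1 and be a vector space over K. For a unit v ≠ 1 let ℓ be the
-- least positive integer with v^ℓ = 1. Since v^n = (n·1_K)·v and v ≠ 1, this forces ℓ·1_K = 0,
-- so ℓ kills every vector; in particular ℓ is prime, for if ℓ = q d properly then q kills
-- v^d ≠ 1, hence kills v. Every unit is thus a root of X^ℓ − 1, so m ≤ ℓ, while Lagrange's
-- theorem gives ℓ ≤ m: m is prime (or m = 1). Conversely an abelian group of prime exponent p
-- is an 𝔽_p-vector space under n·g = g^n. Finally, if p^n − 1 is prime then either p = 2 and
-- it is a Mersenne prime, or p is odd, p^n − 1 is an even prime and q = 3.

open import Defs
open import Level using (Level; Lift; lift; lower)
open import Data.Nat as ℕ
  using ( ℕ; zero; suc; _<_; _≤_; _∸_; _≥_; z≤n; s≤s; z<s; s<s⁻¹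
        ; NonZero; >-nonZero; >-nonZero⁻¹; ≢-nonZero; n>1⇒nonTrivial)
import Data.Nat.Properties as ℕ
open import Data.Nat.DivMod
  using ( _%_; _/_; m≡m%n+[m/n]*n; m<n⇒m%n≡m; m%n<n; m%n%n≡m%n; m*n%n≡0; [m+kn]%n≡m%n
        ; %-distribˡ-+; %-distribˡ-*)
open import Data.Nat.Divisibility
  using (_∣_; _∤_; _∣?_; divides; quotient; quotient≢0; quotient-<; ∣1⇒≡1; ∣m∣n⇒∣m+n; ∣-refl; 1∣_)
open import Data.Nat.Primality
  using ( Prime; Composite; prime; composite; prime[2]
        ; prime⇒irreducible; prime⇒nonZero; prime⇒nonTrivial; euclidsLemma)
open import Data.Nat.Coprimality using (prime⇒coprime; coprime-Bézout)
open import Data.Nat.GCD using (module Bézout)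
open import Data.Fin as Fin using (Fin; punchIn; punchOut)
import Data.Fin.Properties as Fin
open import Data.Vec using (Vec; []; _∷_; replicate)
open import Data.Maybe using (nothing)
open import Data.Product using (∃; _,_; proj₁; proj₂)
open import Data.Sum using (_⊎_; inj₁; inj₂)
open import Function.Base using (_∘_)
open import Function.Bundles using (Inverse; Injection; _⇔_; mk⇔)
open import Function.Properties.Inverse using (Inverse⇒Injection)
open import Function.Construct.Composition using (_⇔-∘_)
import Function.Construct.Composition as Compose
import Function.Construct.Symmetry as Symmetry
open import Relation.Nullary using (¬_; yes; no; contradiction)
open import Relation.Nullary.Decidable using (via-injection)
open import Relation.Unary using (Pred; Decidable)
import Relation.Binary as B
open import Relation.Binary.Bundles using (Setoid)
open import Relation.Binary.PropositionalEquality as ≡ using (_≡_; _≢_)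
open import Algebra.Bundles using (AbelianGroup; CommutativeRing; Semiring)
open import Algebra.Structures using (IsCommutativeRing)
open import Algebra.Module.Structures using (IsLeftModule)
open import Tactic.RingSolver using (solve-∀)
open import Tactic.RingSolver.Core.AlmostCommutativeRing using (AlmostCommutativeRing; fromCommutativeRing)

record Least {p} (P : Pred ℕ p) : Set p where
  field
    value   : ℕ
    holds   : P value
    minimal : ∀ {k} → k < value → ¬ P k

least : ∀ {p} {P : Pred ℕ p} → Decidable P → ∀ {n} → P n → Least P
least P? {zero} P0 = record { value = 0 ; holds = P0 ; minimal = λ () }
least P? {suc n} Pn with P? 0
... | yes P0 = record { value = 0 ; holds = P0 ; minimal = λ () }
... | no ¬P0 = record
  { value   = suc (value L)
  ; holds   = holds L
  ; minimal = λ { {zero} _ → ¬P0 ; {suc k} k<l → minimal L (s<s⁻¹ k<l) }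
  }
  where
    L = least (P? ∘ suc) Pn
    open Least

-- Powers g^n in a multiplicatively written group are the standard library's multiples n × g.
module Multiples {a ℓ} (G : AbelianGroup a ℓ) where
  open AbelianGroup G
  open import Algebra.Properties.Monoid.Mult monoid public
  open import Algebra.Properties.Group group using (identityˡ-unique; \\-leftDividesˡ; \\-leftDividesʳ)
  open import Algebra.Properties.CommutativeMonoid.Sum commutativeMonoid
    using (sum; sum-replicate; ∑-distrib-+; sum-cong-≋; sum-permute)
  open import Relation.Binary.Reasoning.Setoid setoid

  ×-zeroʳ : ∀ n → n × ε ≈ ε
  ×-zeroʳ zero    = refl
  ×-zeroʳ (suc n) = trans (identityˡ _) (×-zeroʳ n)

  ∣-×≈ε : ∀ {d n g} → d ∣ n → d × g ≈ ε → n × g ≈ ε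
  ∣-×≈ε {d} {g = g} (divides a ≡.refl) dg≈ε = begin
    (a ℕ.* d) × g ≈⟨ ×-assocˡ g a d ⟨
    a × (d × g)   ≈⟨ ×-congʳ a dg≈ε ⟩
    a × ε         ≈⟨ ×-zeroʳ a ⟩
    ε             ∎

  ×-mod : ∀ {p g} .{{_ : NonZero p}} → p × g ≈ ε → ∀ n → n × g ≈ (n % p) × g
  ×-mod {p} {g} pg≈ε n = begin
    n × g                             ≡⟨ ≡.cong (_× g) (m≡m%n+[m/n]*n n p) ⟩
    (n % p ℕ.+ (n / p) ℕ.* p) × g     ≈⟨ ×-homo-+ g (n % p) ((n / p) ℕ.* p) ⟩
    (n % p) × g ∙ ((n / p) ℕ.* p) × g ≈⟨ ∙-congˡ (∣-×≈ε (divides (n / p) ≡.refl) pg≈ε) ⟩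
    (n % p) × g ∙ ε                   ≈⟨ identityʳ _ ⟩
    (n % p) × g                       ∎

  record IsOrder (g : Carrier) (n : ℕ) : Set ℓ where
    field
      positive    : 0 < n
      annihilates : n × g ≈ ε
      minimal     : ∀ {k} → 0 < k → k < n → ¬ k × g ≈ ε

  order : B.Decidable _≈_ → ∀ {g n} → 0 < n → n × g ≈ ε → ∃ (IsOrder g)
  order _≟_ {g} {suc n} _ ng≈ε = suc (value L) , record
    { positive    = z<s
    ; annihilates = holds L
    ; minimal     = λ { {suc k} _ k<l → minimal L (s<s⁻¹ k<l) }
    }
    where
      L = least (λ k → (suc k × g) ≟ ε) {n} ng≈ε
      open Least

  order≤ : ∀ {g l n} → IsOrder g l → 0 < n → n × g ≈ ε → l ≤ n
  order≤ o n>0 ng≈ε = ℕ.≮⇒≥ (λ n<l → IsOrder.minimal o n>0 n<l ng≈ε)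

  translation : Carrier → Inverse setoid setoid
  translation g = record
    { to        = g ∙_
    ; from      = g ⁻¹ ∙_
    ; to-cong   = ∙-congˡ
    ; from-cong = ∙-congˡ
    ; inverse   = (λ y≈g⁻¹x → trans (∙-congˡ y≈g⁻¹x) (\\-leftDividesˡ g _))
                , (λ y≈gx → trans (∙-congˡ y≈gx) (\\-leftDividesʳ g _))
    }

  -- Multiplying every element by g permutes G, so the product of all elements P satisfies g^m P = P.
  card×≈ε : ∀ {m} → Inverse setoid (≡.setoid (Fin m)) → ∀ g → m × g ≈ ε
  card×≈ε {m} I g = identityˡ-unique (m × g) (sum from) (begin
    m × g ∙ sum from                   ≈⟨ ∙-congʳ (sum-replicate m) ⟨
    sum {m} (λ _ → g) ∙ sum from       ≈⟨ ∑-distrib-+ (λ _ → g) from ⟨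
    sum {m} (λ i → g ∙ from i)         ≈⟨ sum-cong-≋ (λ i → strictlyInverseʳ (g ∙ from i)) ⟨
    sum (λ i → from (to (g ∙ from i))) ≈⟨ sum-permute {m} from π ⟨
    sum from                           ∎)
    where
      open Inverse I
      π = Compose.inverse (Symmetry.inverse I) (Compose.inverse (translation g) I)

module _ {s ℓ} {S : Setoid s ℓ} {n} (I : Inverse S (≡.setoid (Fin n))) where
  open Setoid S

  ≈-decidable : B.Decidable _≈_
  ≈-decidable = via-injection (Inverse⇒Injection I) Fin._≟_

module _ {s ℓ} {S : Setoid s ℓ} {n} (I : Inverse S (≡.setoid (Fin (suc (suc n))))) where
  open Setoid S
  open Inverse I

  ∃≉ : ∀ x → ∃ λ y → ¬ y ≈ x
  ∃≉ x = from j , λ j≈x → Fin.punchInᵢ≢i (to x) Fin.zero (≡.sym (inverseˡ (sym j≈x)))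
    where j = punchIn (to x) Fin.zero

module LinearSpace {k kℓ a ℓ} (K : Field k kℓ) (G : AbelianGroup a ℓ)
                   (V : IsLinearSpaceOver K G) where
  private module K = Field K
  open AbelianGroup G
  open Multiples G
  open import Algebra.Definitions.RawMonoid K.+-rawMonoid using () renaming (_×_ to _×ᴷ_)
  open IsLeftModule (proj₂ V)
  open import Relation.Binary.Reasoning.Setoid setoid

  _·_ : K.Carrier → Carrier → Carrier
  _·_ = proj₁ V

  n×1·g≈n×g : ∀ n g → (n ×ᴷ K.1#) · g ≈ n × g
  n×1·g≈n×g zero    g = *ₗ-zeroˡ g
  n×1·g≈n×g (suc n) g =
    trans (*ₗ-distribʳ g K.1# (n ×ᴷ K.1#)) (∙-cong (*ₗ-identityˡ g) (n×1·g≈n×g n g))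

  ·≈ε⇒≈ε : ∀ {c w} → ¬ c K.≈ K.0# → c · w ≈ ε → w ≈ ε
  ·≈ε⇒≈ε {c} {w} c≉0 cw≈ε = begin
    w              ≈⟨ *ₗ-identityˡ w ⟨
    K.1# · w       ≈⟨ *ₗ-cong (K.trans (K.*-comm c⁻¹ c) (proj₂ (K.inv c c≉0))) refl ⟨
    (c⁻¹ K.* c) · w ≈⟨ *ₗ-assoc c⁻¹ c w ⟩
    c⁻¹ · (c · w)  ≈⟨ *ₗ-cong K.refl cw≈ε ⟩
    c⁻¹ · ε        ≈⟨ *ₗ-zeroʳ c⁻¹ ⟩
    ε              ∎
    where c⁻¹ = proj₁ (K.inv c c≉0)

  module _ (_≟_ : B.Decidable _≈_) where

    ×-annihilates-all : ∀ {n v} → ¬ v ≈ ε → n × v ≈ ε → ∀ g → n × g ≈ ε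
    ×-annihilates-all {n} {v} v≉ε nv≈ε g with (n × g) ≟ ε
    ... | yes ng≈ε = ng≈ε
    ... | no  ng≉ε = contradiction (·≈ε⇒≈ε n1≉0 (trans (n×1·g≈n×g n v) nv≈ε)) v≉ε
      where
        n1≉0 : ¬ (n ×ᴷ K.1#) K.≈ K.0#
        n1≉0 n1≈0 = ng≉ε (begin
          n × g              ≈⟨ n×1·g≈n×g n g ⟨
          (n ×ᴷ K.1#) · g    ≈⟨ *ₗ-cong n1≈0 refl ⟩
          K.0# · g           ≈⟨ *ₗ-zeroˡ g ⟩
          ε                  ∎)

    order-prime : ∀ {v l} → ¬ v ≈ ε → IsOrder v l → Prime l
    order-prime {v} {l} v≉ε o = prime ⦃ n>1⇒nonTrivial l>1 ⦄ notComposite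
      where
        open IsOrder o
        instance _ = >-nonZero positive

        l>1 : 1 < l
        l>1 = ℕ.≤∧≢⇒< positive λ l≡1 →
          v≉ε (trans (sym (×-homo-1 v)) (≡.subst (λ n → n × v ≈ ε) (≡.sym l≡1) annihilates))

        notComposite : ¬ Composite l
        notComposite (composite {d} d<l d∣l) =
          minimal (>-nonZero⁻¹ q ⦃ quotient≢0 d∣l ⦄) (quotient-< d∣l)
                  (×-annihilates-all {q} dv≉ε q[dv]≈ε v)
          where
            q = quotient d∣l
            dv≉ε : ¬ d × v ≈ ε
            dv≉ε = minimal (ℕ.<-trans z<s (ℕ.nonTrivial⇒n>1 d)) d<l
            q[dv]≈ε : q × (d × v) ≈ ε
            q[dv]≈ε = begin
              q × (d × v)   ≈⟨ ×-assocˡ v q d ⟩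
              (q ℕ.* d) × v ≡⟨ ≡.cong (_× v) (_∣_.equality d∣l) ⟨
              l × v         ≈⟨ annihilates ⟩
              ε             ∎

-- The solver cannot cancel r − r in a ring without decidable equality, so the divisor X − r
-- enters these identities as a variable δ, with x written as δ + r.
module SyntheticDivision {c ℓ} (CR : CommutativeRing c ℓ) where
  private
    R : AlmostCommutativeRing c ℓ
    R = fromCommutativeRing CR (λ _ → nothing)
  open AlmostCommutativeRing R

  divide-linear : ∀ a δ r → a + (δ + r) * 1# ≈ δ * 1# + (a + r * 1#)
  divide-linear = solve-∀ R

  divide-step : ∀ a δ r h g → a + (δ + r) * (δ * h + g) ≈ δ * (g + (δ + r) * h) + (a + r * g)
  divide-step = solve-∀ R

module Polynomials {c ℓ} (F : Field c ℓ) where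
  open Field F
  open import Algebra.Properties.Group +-group using (x∙y⁻¹≈ε⇒x≈y)
  open import Algebra.Definitions.RawSemiring (Semiring.rawSemiring semiring) using (_^_)
  open import Relation.Binary.Reasoning.Setoid setoid

  open SyntheticDivision commutativeRing

  x*y≈0⇒y≈0 : ∀ {x y} → ¬ x ≈ 0# → x * y ≈ 0# → y ≈ 0#
  x*y≈0⇒y≈0 {x} {y} x≉0 xy≈0 = begin
    y              ≈⟨ *-identityˡ y ⟨
    1# * y         ≈⟨ *-congʳ (trans (*-comm x⁻¹ x) (proj₂ (inv x x≉0))) ⟨
    (x⁻¹ * x) * y  ≈⟨ *-assoc x⁻¹ x y ⟩
    x⁻¹ * (x * y)  ≈⟨ *-congˡ xy≈0 ⟩
    x⁻¹ * 0#       ≈⟨ zeroʳ x⁻¹ ⟩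
    0#             ∎
    where x⁻¹ = proj₁ (inv x x≉0)

  x≈[x-r]+r : ∀ x r → x ≈ (x - r) + r
  x≈[x-r]+r x r = begin
    x              ≈⟨ +-identityʳ x ⟨
    x + 0#         ≈⟨ +-congˡ (-‿inverseˡ r) ⟨
    x + (- r + r)  ≈⟨ +-assoc x (- r) r ⟨
    (x - r) + r    ∎

  -- A vector a₀ … a_{d-1} of length d stands for the monic polynomial a₀ + a₁X + … + a_{d-1}X^{d-1} + X^d.
  eval : ∀ {d} → Vec Carrier d → Carrier → Carrier
  eval []       x = 1#
  eval (a ∷ as) x = a + x * eval as x

  quotientBy : ∀ {d} → Carrier → Vec Carrier (suc d) → Vec Carrier d
  quotientBy r (a ∷ [])         = []
  quotientBy r (a ∷ as@(_ ∷ _)) = eval as r ∷ quotientBy r as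

  eval-quotientBy : ∀ {d} r x (f : Vec Carrier (suc d)) →
                    eval f x ≈ (x - r) * eval (quotientBy r f) x + eval f r
  eval-quotientBy r x (a ∷ []) = begin
    a + x * 1#                  ≈⟨ +-congˡ (*-congʳ (x≈[x-r]+r x r)) ⟩
    a + ((x - r) + r) * 1#      ≈⟨ divide-linear a (x - r) r ⟩
    (x - r) * 1# + (a + r * 1#) ∎
  eval-quotientBy r x (a ∷ as@(_ ∷ _)) = begin
    a + x * eval as x                   ≈⟨ +-congˡ (*-cong (x≈[x-r]+r x r) (eval-quotientBy r x as)) ⟩
    a + (δ + r) * (δ * h + g)           ≈⟨ divide-step a δ r h g ⟩
    δ * (g + (δ + r) * h) + (a + r * g) ≈⟨ +-congʳ (*-congˡ (+-congˡ (*-congʳ (x≈[x-r]+r x r)))) ⟨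
    δ * (g + x * h) + (a + r * g)       ∎
    where
      δ = x - r
      g = eval as r
      h = eval (quotientBy r as) x

  roots≤degree : ∀ {d n} (f : Vec Carrier d) (root : Fin n → Carrier) →
                 (∀ {i j} → root i ≈ root j → i ≡ j) → (∀ i → eval f (root i) ≈ 0#) → n ≤ d
  roots≤degree {n = zero} f root root-injective isRoot = z≤n
  roots≤degree {n = suc n} [] root root-injective isRoot = contradiction (sym (isRoot Fin.zero)) 0≉1
  roots≤degree {n = suc n} f@(_ ∷ _) root root-injective isRoot =
    s≤s (roots≤degree (quotientBy r f) (root ∘ Fin.suc) (Fin.suc-injective ∘ root-injective) isRoot′)
    where
      r = root Fin.zero
      isRoot′ : ∀ i → eval (quotientBy r f) (root (Fin.suc i)) ≈ 0#
      isRoot′ i = x*y≈0⇒y≈0 x-r≉0 (begin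
        (x - r) * eval (quotientBy r f) x          ≈⟨ +-identityʳ _ ⟨
        (x - r) * eval (quotientBy r f) x + 0#     ≈⟨ +-congˡ (isRoot Fin.zero) ⟨
        (x - r) * eval (quotientBy r f) x + eval f r ≈⟨ eval-quotientBy r x f ⟨
        eval f x                                   ≈⟨ isRoot (Fin.suc i) ⟩
        0#                                         ∎)
        where
          x = root (Fin.suc i)
          x-r≉0 : ¬ x - r ≈ 0#
          x-r≉0 x-r≈0 with root-injective (x∙y⁻¹≈ε⇒x≈y x r x-r≈0)
          ... | ()

  X^[1+_]-1 : ∀ l → Vec Carrier (suc l)
  X^[1+ l ]-1 = - 1# ∷ replicate l 0#

  eval-X^[1+l]-1 : ∀ l x → eval X^[1+ l ]-1 x ≈ - 1# + x ^ suc l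
  eval-X^[1+l]-1 l x = +-congˡ (*-congˡ (eval-zeros l))
    where
      eval-zeros : ∀ l → eval (replicate l 0#) x ≈ x ^ l
      eval-zeros zero    = refl
      eval-zeros (suc l) = trans (+-identityˡ _) (*-congˡ (eval-zeros l))

module PrimeField {p} (p-prime : Prime p) (k kℓ : Level) where
  private instance p≢0 = prime⇒nonZero p-prime

  infix 4 _≡[mod]_
  _≡[mod]_ : ℕ → ℕ → Set
  m ≡[mod] n = m % p ≡ n % p

  +-cong-mod : ∀ {m m′ n n′} → m ≡[mod] m′ → n ≡[mod] n′ → m ℕ.+ n ≡[mod] m′ ℕ.+ n′
  +-cong-mod {m} {m′} {n} {n′} m≡m′ n≡n′ = begin
    (m ℕ.+ n) % p             ≡⟨ %-distribˡ-+ m n p ⟩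
    (m % p ℕ.+ n % p) % p     ≡⟨ ≡.cong₂ (λ a b → (a ℕ.+ b) % p) m≡m′ n≡n′ ⟩
    (m′ % p ℕ.+ n′ % p) % p   ≡⟨ %-distribˡ-+ m′ n′ p ⟨
    (m′ ℕ.+ n′) % p           ∎
    where open ≡.≡-Reasoning

  *-cong-mod : ∀ {m m′ n n′} → m ≡[mod] m′ → n ≡[mod] n′ → m ℕ.* n ≡[mod] m′ ℕ.* n′
  *-cong-mod {m} {m′} {n} {n′} m≡m′ n≡n′ = begin
    (m ℕ.* n) % p             ≡⟨ %-distribˡ-* m n p ⟩
    (m % p ℕ.* (n % p)) % p   ≡⟨ ≡.cong₂ (λ a b → (a ℕ.* b) % p) m≡m′ n≡n′ ⟩
    (m′ % p ℕ.* (n′ % p)) % p ≡⟨ %-distribˡ-* m′ n′ p ⟨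
    (m′ ℕ.* n′) % p           ∎
    where open ≡.≡-Reasoning

  multiple≡[mod]0 : ∀ n → n ℕ.* p ≡[mod] 0
  multiple≡[mod]0 n = ≡.trans (m*n%n≡0 n p) (≡.sym (m*n%n≡0 0 p))

  infix  8 -_
  infixl 7 _*_
  infixl 6 _+_
  infix  4 _≈_

  Carrier : Set k
  Carrier = Lift k ℕ

  _≈_ : Carrier → Carrier → Set kℓ
  x ≈ y = Lift kℓ (lower x ≡[mod] lower y)

  _+_ _*_ : Carrier → Carrier → Carrier
  x + y = lift (lower x ℕ.+ lower y)
  x * y = lift (lower x ℕ.* lower y)

  -- Multiplication by p ∸ 1, a representative of −1, avoids truncated subtraction.
  -_ : Carrier → Carrier
  - x = lift ((p ℕ.∸ 1) ℕ.* lower x)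

  0# 1# : Carrier
  0# = lift 0
  1# = lift 1

  ≡⇒≈ : ∀ {x y} → lower x ≡ lower y → x ≈ y
  ≡⇒≈ eq = lift (≡.cong (_% p) eq)

  -x+x≈0 : ∀ x → - x + x ≈ 0#
  -x+x≈0 (lift n) = lift (≡.trans (≡.cong (_% p) -n+n≡n*p) (multiple≡[mod]0 n))
    where
      -n+n≡n*p : (p ℕ.∸ 1) ℕ.* n ℕ.+ n ≡ n ℕ.* p
      -n+n≡n*p = begin
        (p ℕ.∸ 1) ℕ.* n ℕ.+ n    ≡⟨ ℕ.+-comm _ n ⟩
        n ℕ.+ (p ℕ.∸ 1) ℕ.* n    ≡⟨ ≡.cong (n ℕ.+_) (ℕ.*-comm (p ℕ.∸ 1) n) ⟩
        n ℕ.+ n ℕ.* (p ℕ.∸ 1)    ≡⟨ ℕ.*-suc n (p ℕ.∸ 1) ⟨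
        n ℕ.* suc (p ℕ.∸ 1)      ≡⟨ ≡.cong (n ℕ.*_) (ℕ.m+[n∸m]≡n (ℕ.>-nonZero⁻¹ p)) ⟩
        n ℕ.* p                  ∎
        where open ≡.≡-Reasoning

  isCommutativeRing : IsCommutativeRing _≈_ _+_ _*_ -_ 0# 1#
  isCommutativeRing = record
    { isRing = record
      { +-isAbelianGroup = record
        { isGroup = record
          { isMonoid = record
            { isSemigroup = record
              { isMagma = record
                { isEquivalence = record
                  { refl  = lift ≡.refl
                  ; sym   = λ x≈y → lift (≡.sym (lower x≈y))
                  ; trans = λ x≈y y≈z → lift (≡.trans (lower x≈y) (lower y≈z))
                  }
                ; ∙-cong = λ x≈y u≈v → lift (+-cong-mod (lower x≈y) (lower u≈v))
                }
              ; assoc = λ x y z → ≡⇒≈ (ℕ.+-assoc (lower x) (lower y) (lower z))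
              }
            ; identity = (λ x → ≡⇒≈ (ℕ.+-identityˡ (lower x))) , (λ x → ≡⇒≈ (ℕ.+-identityʳ (lower x)))
            }
          ; inverse = -x+x≈0 , (λ x → trans′ (≡⇒≈ (ℕ.+-comm (lower x) _)) (-x+x≈0 x))
          ; ⁻¹-cong = λ x≈y → lift (*-cong-mod {p ℕ.∸ 1} ≡.refl (lower x≈y))
          }
        ; comm = λ x y → ≡⇒≈ (ℕ.+-comm (lower x) (lower y))
        }
      ; *-cong = λ x≈y u≈v → lift (*-cong-mod (lower x≈y) (lower u≈v))
      ; *-assoc = λ x y z → ≡⇒≈ (ℕ.*-assoc (lower x) (lower y) (lower z))
      ; *-identity = (λ x → ≡⇒≈ (ℕ.*-identityˡ (lower x))) , (λ x → ≡⇒≈ (ℕ.*-identityʳ (lower x)))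
      ; distrib = (λ x y z → ≡⇒≈ (ℕ.*-distribˡ-+ (lower x) (lower y) (lower z)))
                , (λ x y z → ≡⇒≈ (ℕ.*-distribʳ-+ (lower x) (lower y) (lower z)))
      }
    ; *-comm = λ x y → ≡⇒≈ (ℕ.*-comm (lower x) (lower y))
    }
    where
      trans′ : ∀ {x y z} → x ≈ y → y ≈ z → x ≈ z
      trans′ x≈y y≈z = lift (≡.trans (lower x≈y) (lower y≈z))

  commutativeRing : CommutativeRing k kℓ
  commutativeRing = record { isCommutativeRing = isCommutativeRing }

  private
    module R = CommutativeRing commutativeRing
    open import Algebra.Properties.Ring R.ring using (-‿distribʳ-*; -‿involutive)
    open import Algebra.Properties.Group R.+-group using (inverseʳ-unique)
    open import Relation.Binary.Reasoning.Setoid R.setoid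

  1%p≡1 : 1 % p ≡ 1
  1%p≡1 = m<n⇒m%n≡m (ℕ.nonTrivial⇒n>1 p ⦃ prime⇒nonTrivial p-prime ⦄)

  inverse : ∀ x → ¬ x ≈ 0# → ∃ λ y → x * y ≈ 1#
  inverse x x≉0 = fromBézout (coprime-Bézout (prime⇒coprime p-prime ⦃ ≢-nonZero r≢0 ⦄ (m%n<n (lower x) p)))
    where
      r = lower x % p

      r≢0 : r ≢ 0
      r≢0 r≡0 = x≉0 (lift (≡.trans r≡0 (≡.sym (m*n%n≡0 0 p))))

      x≈r : x ≈ lift r
      x≈r = lift (≡.sym (m%n%n≡m%n (lower x) p))

      fromBézout : Bézout.Identity 1 p r → ∃ λ y → x * y ≈ 1#
      fromBézout (Bézout.-+ a b 1+ap≡br) = lift b , (begin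
        x * lift b            ≈⟨ R.*-congʳ x≈r ⟩
        lift r * lift b       ≈⟨ R.*-comm (lift r) (lift b) ⟩
        lift (b ℕ.* r)        ≈⟨ ≡⇒≈ (≡.sym 1+ap≡br) ⟩
        lift (1 ℕ.+ a ℕ.* p)  ≈⟨ lift ([m+kn]%n≡m%n 1 a p) ⟩
        1#                    ∎)
      fromBézout (Bézout.+- a b 1+br≡ap) = - lift b , (begin
        x * - lift b          ≈⟨ R.*-congʳ x≈r ⟩
        lift r * - lift b     ≈⟨ -‿distribʳ-* (lift r) (lift b) ⟨
        - (lift r * lift b)   ≈⟨ R.-‿cong (inverseʳ-unique 1# (lift r * lift b) 1+rb≈0) ⟩
        - - 1#                ≈⟨ -‿involutive 1# ⟩
        1#                    ∎)
        where
          1+rb≈0 : 1# + lift r * lift b ≈ 0#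
          1+rb≈0 = begin
            1# + lift r * lift b  ≈⟨ R.+-congˡ (R.*-comm (lift r) (lift b)) ⟩
            lift (1 ℕ.+ b ℕ.* r)  ≈⟨ ≡⇒≈ 1+br≡ap ⟩
            lift (a ℕ.* p)        ≈⟨ lift (multiple≡[mod]0 a) ⟩
            0#                    ∎

  𝔽ₚ : Field k kℓ
  𝔽ₚ = record
    { commutativeRing = commutativeRing
    ; 0≉1             = λ 0≈1 → ℕ.0≢1+n (≡.trans (≡.sym (m*n%n≡0 0 p)) (≡.trans (lower 0≈1) 1%p≡1))
    ; inv             = inverse
    }

module _ {a ℓ} (G : AbelianGroup a ℓ) where
  open AbelianGroup G
  open Multiples G
  open import Algebra.Properties.CommutativeMonoid.Mult commutativeMonoid using (×-distrib-+)

  exponent⇒linearSpace : ∀ {p} (p-prime : Prime p) k kℓ → (∀ g → p × g ≈ ε) →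
                         IsLinearSpaceOver (PrimeField.𝔽ₚ p-prime k kℓ) G
  exponent⇒linearSpace {p} p-prime k kℓ exponent = (λ x g → lower x × g) , record
    { isLeftSemimodule = record
      { +ᴹ-isCommutativeMonoid = isCommutativeMonoid
      ; isPreleftSemimodule = record
        { *ₗ-cong      = λ {x} {y} {g} {h} x≈y g≈h → begin
            lower x × g            ≈⟨ ×-mod {p} (exponent g) (lower x) ⟩
            (lower x % p) × g      ≡⟨ ≡.cong (_× g) (lower x≈y) ⟩
            (lower y % p) × g      ≈⟨ ×-mod {p} (exponent g) (lower y) ⟨
            lower y × g            ≈⟨ ×-congʳ (lower y) g≈h ⟩
            lower y × h            ∎
        ; *ₗ-zeroˡ     = λ _ → refl
        ; *ₗ-distribʳ  = λ g x y → ×-homo-+ g (lower x) (lower y)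
        ; *ₗ-identityˡ = ×-homo-1
        ; *ₗ-assoc     = λ x y g → sym (×-assocˡ g (lower x) (lower y))
        ; *ₗ-zeroʳ     = λ x → ×-zeroʳ (lower x)
        ; *ₗ-distribˡ  = λ x g h → ×-distrib-+ g h (lower x)
        }
      }
    ; -ᴹ‿cong    = ⁻¹-cong
    ; -ᴹ‿inverse = inverse
    }
    where
      instance _ = prime⇒nonZero p-prime
      open import Relation.Binary.Reasoning.Setoid setoid

  card≡1∨prime⇒linearSpace : ∀ {m} k kℓ → Inverse setoid (≡.setoid (Fin m)) → m ≡ 1 ⊎ Prime m →
                             IsLinearSpace k kℓ G
  card≡1∨prime⇒linearSpace k kℓ I (inj₁ ≡.refl) =
    PrimeField.𝔽ₚ prime[2] k kℓ ,
    exponent⇒linearSpace prime[2] k kℓ (λ g → ∣-×≈ε (1∣ 2) (card×≈ε I g))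
  card≡1∨prime⇒linearSpace k kℓ I (inj₂ m-prime) =
    PrimeField.𝔽ₚ m-prime k kℓ , exponent⇒linearSpace m-prime k kℓ (card×≈ε I)

module UnitGroup {c ℓ} (F : Field c ℓ) where
  open Field F
  private module G = AbelianGroup (unitGroup F)
  open Multiples (unitGroup F)
  open Polynomials F
  open import Algebra.Definitions.RawSemiring (Semiring.rawSemiring semiring) using (_^_)
  open import Relation.Binary.Reasoning.Setoid setoid

  units↔Fin : ∀ {m} → Inverse setoid (≡.setoid (Fin (suc m))) → Inverse G.setoid (≡.setoid (Fin m))
  units↔Fin I = record
    { to        = toᵘ
    ; from      = fromᵘ
    ; to-cong   = λ {u} {w} → toᵘ-cong {u} {w}
    ; from-cong = λ { ≡.refl → refl }
    ; inverse   = (λ {i} {u} u≈i → ≡.trans (toᵘ-cong {u} {fromᵘ i} u≈i) (strictlyInverseˡᵘ i))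
                , (λ { {u} ≡.refl → strictlyInverseʳᵘ u })
    }
    where
      open Inverse I
      toᵘ : G.Carrier → Fin _
      toᵘ (x , x≉0) =
        punchOut {i = to 0#} {j = to x} (x≉0 ∘ Injection.injective (Inverse⇒Injection I) ∘ ≡.sym)
      toᵘ-cong : ∀ {u w} → u G.≈ w → toᵘ u ≡ toᵘ w
      toᵘ-cong = Fin.punchOut-cong (to 0#) ∘ to-cong
      fromᵘ : Fin _ → G.Carrier
      fromᵘ i = from (punchIn (to 0#) i) , λ x≈0 → Fin.punchInᵢ≢i (to 0#) i (≡.sym (inverseˡ (sym x≈0)))
      strictlyInverseˡᵘ : ∀ i → toᵘ (fromᵘ i) ≡ i
      strictlyInverseˡᵘ i = ≡.trans (Fin.punchOut-cong (to 0#) (strictlyInverseˡ (punchIn (to 0#) i)))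
                                    (Fin.punchOut-punchIn (to 0#))
      strictlyInverseʳᵘ : ∀ u → fromᵘ (toᵘ u) G.≈ u
      strictlyInverseʳᵘ (x , _) = trans (from-cong (Fin.punchIn-punchOut _)) (strictlyInverseʳ x)

  proj₁-× : ∀ n u → proj₁ (n × u) ≡ proj₁ u ^ n
  proj₁-× zero    u = ≡.refl
  proj₁-× (suc n) u = ≡.cong (proj₁ u *_) (proj₁-× n u)

  card≤exponent : ∀ {m l} → Inverse G.setoid (≡.setoid (Fin m)) → 0 < l →
                  (∀ u → l × u G.≈ G.ε) → m ≤ l
  card≤exponent {l = suc l} I _ exponent =
    roots≤degree X^[1+ l ]-1 (proj₁ ∘ from)
                 (Injection.injective (Inverse⇒Injection (Symmetry.inverse I))) isRoot
    where
      open Inverse I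
      isRoot : ∀ i → eval X^[1+ l ]-1 (proj₁ (from i)) ≈ 0#
      isRoot i = begin
        eval X^[1+ l ]-1 (proj₁ (from i))  ≈⟨ eval-X^[1+l]-1 l (proj₁ (from i)) ⟩
        - 1# + proj₁ (from i) ^ suc l      ≡⟨ ≡.cong (- 1# +_) (proj₁-× (suc l) (from i)) ⟨
        - 1# + proj₁ (suc l × from i)      ≈⟨ +-congˡ (exponent (from i)) ⟩
        - 1# + 1#                          ≈⟨ -‿inverseˡ 1# ⟩
        0#                                 ∎

  linearSpace⇒card≡1∨prime : ∀ {m k kℓ} → Inverse setoid (≡.setoid (Fin (suc m))) →
                             IsLinearSpace k kℓ (unitGroup F) → m ≡ 1 ⊎ Prime m
  linearSpace⇒card≡1∨prime {zero} I _ =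
    contradiction (Injection.injective (Inverse⇒Injection I) (Fin1-unique _ _)) 0≉1
    where
      Fin1-unique : ∀ (i j : Fin 1) → i ≡ j
      Fin1-unique Fin.zero Fin.zero = ≡.refl
  linearSpace⇒card≡1∨prime {suc zero} I _ = inj₁ ≡.refl
  linearSpace⇒card≡1∨prime {suc (suc m)} I (K , V) =
    inj₂ (≡.subst Prime (ℕ.≤-antisym ord≤m m≤ord) ord-prime)
    where
      open LinearSpace K (unitGroup F) V
      I′ = units↔Fin I
      _≟_ = ≈-decidable I′
      v : G.Carrier
      v = proj₁ (∃≉ I′ G.ε)
      v≉ε : ¬ v G.≈ G.ε
      v≉ε = proj₂ (∃≉ I′ G.ε)
      v-order : ∃ (IsOrder v)
      v-order = order _≟_ {v} {suc (suc m)} z<s (card×≈ε I′ v)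
      ord = proj₁ v-order
      o = proj₂ v-order
      ord≤m : ord ≤ suc (suc m)
      ord≤m = order≤ {n = suc (suc m)} o z<s (card×≈ε I′ v)
      m≤ord : suc (suc m) ≤ ord
      m≤ord = card≤exponent {l = ord} I′ (IsOrder.positive o)
                            (×-annihilates-all _≟_ {ord} v≉ε (IsOrder.annihilates o))
      ord-prime : Prime ord
      ord-prime = order-prime _≟_ v≉ε o

  linearSpace⇔card≡1∨prime : ∀ {m} k kℓ → Inverse setoid (≡.setoid (Fin (suc m))) →
                             IsLinearSpace k kℓ (unitGroup F) ⇔ (m ≡ 1 ⊎ Prime m)
  linearSpace⇔card≡1∨prime k kℓ I =
    mk⇔ (linearSpace⇒card≡1∨prime I) (card≡1∨prime⇒linearSpace (unitGroup F) k kℓ (units↔Fin I))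

2∣n⊎2∣1+n : ∀ n → 2 ∣ n ⊎ 2 ∣ suc n
2∣n⊎2∣1+n zero    = inj₁ (divides 0 ≡.refl)
2∣n⊎2∣1+n (suc n) with 2∣n⊎2∣1+n n
... | inj₁ 2∣n   = inj₂ (∣m∣n⇒∣m+n ∣-refl 2∣n)
... | inj₂ 2∣1+n = inj₁ 2∣1+n

even-prime⇒≡2 : ∀ {p} → Prime p → 2 ∣ p → p ≡ 2
even-prime⇒≡2 p-prime 2∣p with prime⇒irreducible p-prime 2∣p
... | inj₂ 2≡p = ≡.sym 2≡p

∤⇒∤^ : ∀ {p} n → 2 ∤ p → 2 ∤ p ℕ.^ n
∤⇒∤^ zero      _   2∣1   = contradiction (∣1⇒≡1 2∣1) λ ()
∤⇒∤^ {p} (suc n) 2∤p 2∣p^1+n with euclidsLemma p (p ℕ.^ n) prime[2] 2∣p^1+n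
... | inj₁ 2∣p   = 2∤p 2∣p
... | inj₂ 2∣p^n = ∤⇒∤^ n 2∤p 2∣p^n

≡1∨prime⇔q≡2∨q≡3∨Mersenne : ∀ {p n m} → Prime p → p ℕ.^ n ≡ suc m →
                (m ≡ 1 ⊎ Prime m) ⇔ (p ℕ.^ n ≡ 2 ⊎ p ℕ.^ n ≡ 3 ⊎ MersennePrime (p ℕ.^ n ∸ 1))
≡1∨prime⇔q≡2∨q≡3∨Mersenne {p} {n} {m} p-prime q≡1+m rewrite q≡1+m = mk⇔ to from
  where
    to : m ≡ 1 ⊎ Prime m → suc m ≡ 2 ⊎ suc m ≡ 3 ⊎ MersennePrime m
    to (inj₁ ≡.refl) = inj₁ ≡.refl
    to (inj₂ m-prime) with 2 ∣? p
    ... | yes 2∣p = inj₂ (inj₂ (m-prime , n , ≡.cong (_∸ 1) 1+m≡2^n))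
      where
        1+m≡2^n : suc m ≡ 2 ℕ.^ n
        1+m≡2^n = ≡.trans (≡.sym q≡1+m) (≡.cong (ℕ._^ n) (even-prime⇒≡2 p-prime 2∣p))
    ... | no  2∤p with 2∣n⊎2∣1+n m
    ...   | inj₁ 2∣m   = inj₂ (inj₁ (≡.cong suc (even-prime⇒≡2 m-prime 2∣m)))
    ...   | inj₂ 2∣1+m = contradiction (≡.subst (2 ∣_) (≡.sym q≡1+m) 2∣1+m) (∤⇒∤^ n 2∤p)
    from : suc m ≡ 2 ⊎ suc m ≡ 3 ⊎ MersennePrime m → m ≡ 1 ⊎ Prime m
    from (inj₁ ≡.refl)                = inj₁ ≡.refl
    from (inj₂ (inj₁ ≡.refl))         = inj₂ prime[2]
    from (inj₂ (inj₂ (m-prime , _))) = inj₂ m-prime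

open import Data.Nat using (_^_)
open import Relation.Binary.PropositionalEquality using (setoid)

theorem1p1 : ∀ {c ℓ : Level} (k kℓ : Level) (p n : ℕ) → Prime p → n ≥ 1 →
    (F : Field c ℓ) → Inverse (Field.setoid F) (setoid (Fin (p ^ n))) →
    (IsLinearSpace k kℓ (unitGroup F) ⇔ (p ^ n ≡ 2 ⊎ p ^ n ≡ 3 ⊎ MersennePrime (p ^ n ∸ 1)))
theorem1p1 k kℓ p n p-prime _ F I =
  ≡1∨prime⇔q≡2∨q≡3∨Mersenne {n = n} p-prime q≡1+m
    ⇔-∘ UnitGroup.linearSpace⇔card≡1∨prime F k kℓ I′
  where
    instance _ = prime⇒nonZero p-prime
    q≡1+m : p ^ n ≡ suc (p ^ n ∸ 1)
    q≡1+m = ≡.sym (ℕ.m+[n∸m]≡n (ℕ.m^n>0 p n))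
    I′ : Inverse (Field.setoid F) (setoid (Fin (suc (p ^ n ∸ 1))))
    I′ = ≡.subst (λ q → Inverse (Field.setoid F) (setoid (Fin q))) q≡1+m I
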